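{- Let $q$ be a prime power, $\mathrm{PG}(3,q)=\mathrm{AG}(3,q)\cup H_\infty$, and let $U\subset\mathrm{AG}(3,q)$ with $|U|=q^2$, $U$ not contained in a plane. Let $\ell_1,\ell_2$ be two distinct lines of $H_\infty$ not determined by $U$, and let $M=\ell_1\cap\ell_2$. If $f$ and $g$ are two distinct parallel affine lines contained in $U$ whose ideal point lies on $\ell_1$, then $U$ is the union of $q$ parallel affine lines whose ideal point is $M$.
   Context: A line $\ell\subset H_\infty$ is determined by $U$ if some affine plane whose line at infinity is $\ell$ contains three non-collinear points of $U$. The ideal point of an affine line is its point at infinity. -}

module Defs where

open import Level using (0ℓ)
open import Data.Nat using (ℕ)
open import Data.Fin using (Fin)
open import Data.Product using (Σ; _×_; _,_; ∃)
open import Data.List using (List)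
open import Data.List.Membership.Propositional using (_∈_)
open import Relation.Nullary using (¬_)
open import Relation.Binary.PropositionalEquality using (_≡_)
open import Algebra.Structures using (IsCommutativeRing)
open import Function.Bundles using (_↔_)

-- A finite field (with propositional equality). Its number of elements
-- `size` is q; finite fields are exactly the GF(q), q a prime power.
record FiniteField : Set₁ where
  infixl 7 _*_
  infixl 6 _+_
  field
    Carrier : Set
    _+_ _*_ : Carrier → Carrier → Carrier
    -_      : Carrier → Carrier
    0# 1#   : Carrier
    isCommutativeRing : IsCommutativeRing _≡_ _+_ _*_ -_ 0# 1#
    0≢1     : ¬ (0# ≡ 1#)
    inverse : ∀ x → ¬ (x ≡ 0#) → Σ Carrier (λ y → x * y ≡ 1#)
    size    : ℕ
    enum    : Carrier ↔ Fin size

-- Coordinates of AG(3,q) = F³ and the plane at infinity H∞ of PG(3,q).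
-- Points of H∞ are nonzero vectors of F³ up to scalar (directions);
-- lines of H∞ are given by homogeneous coordinates [a:b:c] ≠ 0, the line
-- { (d) : a d₁ + b d₂ + c d₃ = 0 }.
module Geometry (F : FiniteField) where
  open FiniteField F

  q : ℕ
  q = size

  record V3 : Set where
    constructor ⟨_,_,_⟩
    field
      x₁ x₂ x₃ : Carrier
  open V3 public

  zero3 : V3
  zero3 = ⟨ 0# , 0# , 0# ⟩

  _⊕_ : V3 → V3 → V3
  u ⊕ v = ⟨ x₁ u + x₁ v , x₂ u + x₂ v , x₃ u + x₃ v ⟩

  _⊖_ : V3 → V3 → V3
  u ⊖ v = ⟨ x₁ u + - x₁ v , x₂ u + - x₂ v , x₃ u + - x₃ v ⟩

  _·_ : Carrier → V3 → V3
  a · v = ⟨ a * x₁ v , a * x₂ v , a * x₃ v ⟩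

  dot : V3 → V3 → Carrier
  dot u v = x₁ u * x₁ v + x₂ u * x₂ v + x₃ u * x₃ v

  Pt : Set
  Pt = V3

  OnLineAtInf : V3 → V3 → Set
  OnLineAtInf d n = dot n d ≡ 0#

  DistinctLinesAtInf : V3 → V3 → Set
  DistinctLinesAtInf n m = ¬ (Σ Carrier λ c → m ≡ c · n)

  NonCollinear : Pt → Pt → Pt → Set
  NonCollinear a b c =
    ∀ (s t : Carrier) → (s · (b ⊖ a)) ⊕ (t · (c ⊖ a)) ≡ zero3 → (s ≡ 0#) × (t ≡ 0#)

  -- the affine line through p with direction d (d ≠ 0); its ideal point is d
  OnAffLine : Pt → V3 → Pt → Set
  OnAffLine p d x = Σ Carrier λ t → x ≡ p ⊕ (t · d)

  LineInU : List Pt → Pt → V3 → Set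
  LineInU U p d = ∀ (t : Carrier) → (p ⊕ (t · d)) ∈ U

  InAPlane : List Pt → Set
  InAPlane U = Σ V3 λ n → Σ Carrier λ c →
    ¬ (n ≡ zero3) × (∀ u → u ∈ U → dot n u ≡ c)

  -- the line at infinity n is determined by U: some affine plane with line
  -- at infinity n (i.e. { x : n·x = c }) contains three non-collinear points of U
  Determined : List Pt → V3 → Set
  Determined U n = Σ Pt λ a → Σ Pt λ b → Σ Pt λ c →
    (a ∈ U) × (b ∈ U) × (c ∈ U) × NonCollinear a b c ×
    (dot n a ≡ dot n b) × (dot n a ≡ dot n c)

module Submission where

-- Points are vectors of F³; a line of H∞ is a nonzero functional n, and the
-- planes with line at infinity n are the levels of x ↦ n·x.  The geometric core is
-- a criterion producing three non-collinear points in one n-level, which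
-- certifies that n is determined.  Proposition 1 shows that two parallel
-- lines of U force their ideal point onto every undetermined line (else U
-- lies in the plane of f and g), so d ∈ ℓ₂.  Proposition 2 counts points
-- fibrewise over the planes n₁ = c to show that each fibre is a full line
-- with ideal point d.

open import Defs
open import Data.Nat using (ℕ)
open import Data.Fin using (Fin; combine)
open import Data.Product using (Σ; _×_; _,_; proj₁; proj₂)
open import Data.List using (List; length)
open import Data.List.Membership.Propositional using (_∈_; find; lose)
open import Data.List.Relation.Unary.Unique.Propositional using (Unique)
open import Relation.Nullary using (¬_; Dec; yes; no)
open import Relation.Binary.PropositionalEquality
  using (_≡_; refl; sym; trans; cong; cong₂; subst; module ≡-Reasoning)

open import Level using (0ℓ)
open import Data.Nat as ℕ using (zero; suc)
open import Data.Maybe using (Maybe; just; nothing)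
open import Data.Empty using (⊥-elim)
open import Data.Product.Properties using (≡-dec)
open import Data.Fin.Properties using (combine-injective) renaming (_≟_ to _≟ᶠ_)
open import Data.List.Relation.Unary.Any using (any?)
open import Relation.Nullary.Decidable using (map′; _×-dec_; ¬?)
open import Function.Bundles using (Inverse)
open import Algebra.Bundles using (CommutativeRing; RawRing)
open import Algebra.Structures using (IsCommutativeRing)
open import Algebra.Solver.Ring.AlmostCommutativeRing using (_-Raw-AlmostCommutative⟶_; fromCommutativeRing)
import Algebra.Properties.Ring as RingProperties
import Algebra.Properties.Semiring.Mult as SemiringMultiplication

-- The stdlib solver needs a coefficient ring whose
-- equality is decidable by computation; over an abstract ring this is
-- provided by the integers, represented here as pairs (a , b) meaning a − b.
-- Integer coefficients are what make identities such as  x − x = 0  provable.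
module IntegerCoefficientSolver
  {A : Set} {add mul : A → A → A} {neg : A → A} {0r 1r : A}
  (isCommutativeRing : IsCommutativeRing _≡_ add mul neg 0r 1r) where

  CR : CommutativeRing 0ℓ 0ℓ
  CR = record { isCommutativeRing = isCommutativeRing }

  open CommutativeRing CR using (_+_; _*_; -_; 0#; 1#; ring; semiring; +-assoc; +-comm;
    +-identityˡ; +-identityʳ; distribˡ; distribʳ; -‿inverseʳ)
  open RingProperties ring using (-‿distribˡ-*; -‿distribʳ-*; -‿involutive; -‿+-comm; -0#≈0#)
  open SemiringMultiplication semiring using (×-homo-+; ×1-homo-*) renaming (_×_ to _·ℕ_)
  open ≡-Reasoning

  -- integers as differences of naturals, kept reduced (one side zero)
  ℤ₂ : Set
  ℤ₂ = ℕ × ℕ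

  reduce : ℕ → ℕ → ℤ₂
  reduce (suc a) (suc b) = reduce a b
  reduce a       zero    = a , zero
  reduce zero    b       = zero , b

  Coefficients : RawRing 0ℓ 0ℓ
  Coefficients = record
    { Carrier = ℤ₂ ; _≈_ = _≡_ ; 0# = 0 , 0 ; 1# = 1 , 0 ; -_ = λ (a , b) → b , a
    ; _+_ = λ (a , b) (c , d) → reduce (a ℕ.+ c) (b ℕ.+ d)
    ; _*_ = λ (a , b) (c , d) → reduce (a ℕ.* c ℕ.+ b ℕ.* d) (a ℕ.* d ℕ.+ b ℕ.* c) }

  ι : ℕ → A
  ι n = n ·ℕ 1#

  ⟦_⟧₀ : ℤ₂ → A
  ⟦ a , b ⟧₀ = ι a + - ι b

  -- the interpretation actually used: it sends the coefficients 0 and 1 to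
  -- 0# and 1# on the nose, so that solver statements mention 0# and 1#
  ⟦_⟧ : ℤ₂ → A
  ⟦ zero , zero ⟧ = 0#
  ⟦ suc zero , zero ⟧ = 1#
  ⟦ x ⟧ = ⟦ x ⟧₀

  ⟦⟧-canonical : ∀ x → ⟦ x ⟧ ≡ ⟦ x ⟧₀
  ⟦⟧-canonical (zero , zero) = sym (trans (+-identityˡ _) -0#≈0#)
  ⟦⟧-canonical (suc zero , zero) =
    sym (trans (cong₂ _+_ (+-identityʳ 1#) -0#≈0#) (+-identityʳ 1#))
  ⟦⟧-canonical (zero , suc b) = refl
  ⟦⟧-canonical (suc zero , suc b) = refl
  ⟦⟧-canonical (suc (suc a) , b) = refl

  interchange : ∀ x y z w → (x + y) + (z + w) ≡ (x + z) + (y + w)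
  interchange x y z w = begin
    (x + y) + (z + w)   ≡⟨ +-assoc x y _ ⟩
    x + (y + (z + w))   ≡⟨ cong (x +_) (sym (+-assoc y z w)) ⟩
    x + ((y + z) + w)   ≡⟨ cong (λ u → x + (u + w)) (+-comm y z) ⟩
    x + ((z + y) + w)   ≡⟨ cong (x +_) (+-assoc z y w) ⟩
    x + (z + (y + w))   ≡⟨ sym (+-assoc x z _) ⟩
    (x + z) + (y + w)   ∎

  difference-of-sums : ∀ x y z w → (x + z) + - (y + w) ≡ (x + - y) + (z + - w)
  difference-of-sums x y z w = begin
    (x + z) + - (y + w)     ≡⟨ cong ((x + z) +_) (sym (-‿+-comm y w)) ⟩
    (x + z) + (- y + - w)   ≡⟨ interchange x z (- y) (- w) ⟩
    (x + - y) + (z + - w)   ∎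

  reduce-correct : ∀ a b → ⟦ reduce a b ⟧₀ ≡ ⟦ a , b ⟧₀
  reduce-correct (suc a) (suc b) = begin
    ⟦ reduce a b ⟧₀                     ≡⟨ reduce-correct a b ⟩
    ι a + - ι b                         ≡⟨ sym (+-identityʳ _) ⟩
    (ι a + - ι b) + 0#                  ≡⟨ cong ((ι a + - ι b) +_) (sym (-‿inverseʳ 1#)) ⟩
    (ι a + - ι b) + (1# + - 1#)         ≡⟨ sym (difference-of-sums (ι a) (ι b) 1# 1#) ⟩
    (ι a + 1#) + - (ι b + 1#)           ≡⟨ cong₂ (λ u v → u + - v) (+-comm _ 1#) (+-comm _ 1#) ⟩
    ι (suc a) + - ι (suc b)             ∎
  reduce-correct zero    zero    = refl
  reduce-correct (suc a) zero    = refl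
  reduce-correct zero    (suc b) = refl

  +-homo : ∀ x y → ⟦ RawRing._+_ Coefficients x y ⟧ ≡ ⟦ x ⟧ + ⟦ y ⟧
  +-homo (a , b) (c , d) = begin
    ⟦ reduce (a ℕ.+ c) (b ℕ.+ d) ⟧          ≡⟨ ⟦⟧-canonical (reduce (a ℕ.+ c) (b ℕ.+ d)) ⟩
    ⟦ reduce (a ℕ.+ c) (b ℕ.+ d) ⟧₀         ≡⟨ reduce-correct (a ℕ.+ c) (b ℕ.+ d) ⟩
    ι (a ℕ.+ c) + - ι (b ℕ.+ d)             ≡⟨ cong₂ (λ u v → u + - v) (×-homo-+ 1# a c) (×-homo-+ 1# b d) ⟩
    (ι a + ι c) + - (ι b + ι d)             ≡⟨ difference-of-sums (ι a) (ι b) (ι c) (ι d) ⟩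
    ⟦ a , b ⟧₀ + ⟦ c , d ⟧₀                 ≡⟨ sym (cong₂ _+_ (⟦⟧-canonical (a , b)) (⟦⟧-canonical (c , d))) ⟩
    ⟦ a , b ⟧ + ⟦ c , d ⟧                   ∎

  product-of-differences : ∀ x y z w → (x * z + y * w) + - (x * w + y * z) ≡ (x + - y) * (z + - w)
  product-of-differences x y z w = begin
    (x * z + y * w) + - (x * w + y * z)         ≡⟨ difference-of-sums (x * z) (x * w) (y * w) (y * z) ⟩
    (x * z + - (x * w)) + (y * w + - (y * z))   ≡⟨ cong₂ _+_ (cong (x * z +_) (-‿distribʳ-* x w))
                                                   (cong₂ _+_ (sym (-‿involutive (y * w))) (-‿distribˡ-* y z)) ⟩
    (x * z + x * - w) + (- - (y * w) + - y * z)  ≡⟨ cong₂ _+_ (sym (distribˡ x z (- w)))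
                                                   (cong (λ u → - u + - y * z) (-‿distribˡ-* y w)) ⟩
    x * (z + - w) + (- (- y * w) + - y * z)     ≡⟨ cong (λ u → x * (z + - w) + (u + - y * z)) (-‿distribʳ-* (- y) w) ⟩
    x * (z + - w) + (- y * - w + - y * z)       ≡⟨ cong (x * (z + - w) +_) (trans (+-comm _ _) (sym (distribˡ (- y) z (- w)))) ⟩
    x * (z + - w) + - y * (z + - w)             ≡⟨ sym (distribʳ _ x (- y)) ⟩
    (x + - y) * (z + - w)                       ∎

  *-homo : ∀ x y → ⟦ RawRing._*_ Coefficients x y ⟧ ≡ ⟦ x ⟧ * ⟦ y ⟧
  *-homo (a , b) (c , d) = begin
    ⟦ reduce (a ℕ.* c ℕ.+ b ℕ.* d) (a ℕ.* d ℕ.+ b ℕ.* c) ⟧    ≡⟨ ⟦⟧-canonical (reduce (a ℕ.* c ℕ.+ b ℕ.* d) (a ℕ.* d ℕ.+ b ℕ.* c)) ⟩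
    ⟦ reduce (a ℕ.* c ℕ.+ b ℕ.* d) (a ℕ.* d ℕ.+ b ℕ.* c) ⟧₀   ≡⟨ reduce-correct (a ℕ.* c ℕ.+ b ℕ.* d) (a ℕ.* d ℕ.+ b ℕ.* c) ⟩
    ι (a ℕ.* c ℕ.+ b ℕ.* d) + - ι (a ℕ.* d ℕ.+ b ℕ.* c)          ≡⟨ cong₂ (λ u v → u + - v) (ι-bilinear a c b d) (ι-bilinear a d b c) ⟩
    (ι a * ι c + ι b * ι d) + - (ι a * ι d + ι b * ι c)          ≡⟨ product-of-differences (ι a) (ι b) (ι c) (ι d) ⟩
    ⟦ a , b ⟧₀ * ⟦ c , d ⟧₀                                      ≡⟨ sym (cong₂ _*_ (⟦⟧-canonical (a , b)) (⟦⟧-canonical (c , d))) ⟩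
    ⟦ a , b ⟧ * ⟦ c , d ⟧                                        ∎
    where
    ι-bilinear : ∀ m n k l → ι (m ℕ.* n ℕ.+ k ℕ.* l) ≡ ι m * ι n + ι k * ι l
    ι-bilinear m n k l = trans (×-homo-+ 1# (m ℕ.* n) (k ℕ.* l)) (cong₂ _+_ (×1-homo-* m n) (×1-homo-* k l))

  -‿homo : ∀ x → ⟦ RawRing.-_ Coefficients x ⟧ ≡ - ⟦ x ⟧
  -‿homo (a , b) = begin
    ⟦ b , a ⟧              ≡⟨ ⟦⟧-canonical (b , a) ⟩
    ι b + - ι a            ≡⟨ cong (_+ - ι a) (sym (-‿involutive _)) ⟩
    - - ι b + - ι a        ≡⟨ -‿+-comm _ _ ⟩
    - (- ι b + ι a)        ≡⟨ cong -_ (trans (+-comm _ _) (sym (⟦⟧-canonical (a , b)))) ⟩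
    - ⟦ a , b ⟧            ∎

  morphism : Coefficients -Raw-AlmostCommutative⟶ fromCommutativeRing CR
  morphism = record { ⟦_⟧ = ⟦_⟧ ; +-homo = +-homo ; *-homo = *-homo ; -‿homo = -‿homo
                    ; 0-homo = refl ; 1-homo = refl }

  coefficient-equality : ∀ x y → Maybe (⟦ x ⟧ ≡ ⟦ y ⟧)
  coefficient-equality x y with ≡-dec ℕ._≟_ ℕ._≟_ x y
  ... | yes refl = just refl
  ... | no _     = nothing

  open import Algebra.Solver.Ring Coefficients (fromCommutativeRing CR) morphism coefficient-equality public
    using (solve; _:=_; _:+_; _:*_; _:-_; con)

module Counting where
  open import Data.List using ([]; _∷_; lookup)
  open import Data.List.Relation.Unary.All using () renaming (lookup to All-lookup)
  open import Data.List.Relation.Unary.AllPairs using (_∷_)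
  open import Data.List.Membership.Propositional.Properties using (∈-lookup)
  open import Data.Fin using (punchOut) renaming (zero to fzero; suc to fsuc)
  open import Data.Fin.Properties using (punchOut-injective; injective⇒≤)
  open import Data.Nat.Properties using (1+n≰n)

  lookup-injective : ∀ {A : Set} (xs : List A) → Unique xs →
    ∀ i j → lookup xs i ≡ lookup xs j → i ≡ j
  lookup-injective (x ∷ xs) (x∉xs ∷ u) fzero    fzero    e = refl
  lookup-injective (x ∷ xs) (x∉xs ∷ u) fzero    (fsuc j) e = ⊥-elim (All-lookup x∉xs (∈-lookup j) e)
  lookup-injective (x ∷ xs) (x∉xs ∷ u) (fsuc i) fzero    e = ⊥-elim (All-lookup x∉xs (∈-lookup i) (sym e))
  lookup-injective (x ∷ xs) (x∉xs ∷ u) (fsuc i) (fsuc j) e = cong fsuc (lookup-injective xs u i j e)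

  -- an injection from a duplicate-free list of length N into Fin N is onto;
  -- this is how |U| = q² enters the proof
  injection-onto : ∀ {A : Set} (xs : List A) → Unique xs → ∀ {N} → length xs ≡ N →
    (g : A → Fin N) → (∀ {x y} → x ∈ xs → y ∈ xs → g x ≡ g y → x ≡ y) →
    ∀ k → Σ A λ x → x ∈ xs × g x ≡ k
  injection-onto [] u refl g g-inj ()
  injection-onto xs@(_ ∷ ys) u refl g g-inj k with any? (λ x → g x ≟ᶠ k) xs
  ... | yes hit = find hit
  ... | no miss = ⊥-elim (1+n≰n (injective⇒≤ squeeze-injective))
    where
    -- if k is missed, the positions of xs inject into Fin N ∖ {k}
    avoids : ∀ i → ¬ k ≡ g (lookup xs i)
    avoids i e = miss (lose (∈-lookup i) (sym e))
    squeeze : Fin (length xs) → Fin (length ys)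
    squeeze i = punchOut (avoids i)

    squeeze-injective : ∀ {i j} → squeeze i ≡ squeeze j → i ≡ j
    squeeze-injective {i} {j} e = lookup-injective xs u i j
      (g-inj (∈-lookup i) (∈-lookup j) (punchOut-injective (avoids i) (avoids j) e))

module Space (F : FiniteField) where
  open FiniteField F
  open Geometry F
  open IntegerCoefficientSolver isCommutativeRing using (CR; solve; _:=_; _:+_; _:*_; _:-_; con)
  open CommutativeRing CR using (ring; *-comm; *-identityˡ; zeroˡ; zeroʳ)
  open RingProperties ring using (x∙y⁻¹≈ε⇒x≈y; x≈y⇒x∙y⁻¹≈ε)
  open Inverse enum using (to; from; strictlyInverseʳ)
  open ≡-Reasoning

  to-injective : ∀ {x y} → to x ≡ to y → x ≡ y
  to-injective {x} {y} e = trans (sym (strictlyInverseʳ x)) (trans (cong from e) (strictlyInverseʳ y))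

  _≟_ : (x y : Carrier) → Dec (x ≡ y)
  x ≟ y = map′ to-injective (cong to) (to x ≟ᶠ to y)

  no-zero-divisorsˡ : ∀ a b → ¬ a ≡ 0# → a * b ≡ 0# → b ≡ 0#
  no-zero-divisorsˡ a b a≢0 ab≡0 with inverse a a≢0
  ... | a⁻¹ , aa⁻¹≡1 = begin
    b               ≡⟨ sym (*-identityˡ b) ⟩
    1# * b          ≡⟨ cong (_* b) (sym aa⁻¹≡1) ⟩
    (a * a⁻¹) * b   ≡⟨ solve 3 (λ a a⁻¹ b → (a :* a⁻¹) :* b := a⁻¹ :* (a :* b)) refl a a⁻¹ b ⟩
    a⁻¹ * (a * b)   ≡⟨ cong (a⁻¹ *_) ab≡0 ⟩
    a⁻¹ * 0#        ≡⟨ zeroʳ a⁻¹ ⟩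
    0#              ∎

  no-zero-divisorsʳ : ∀ a b → ¬ b ≡ 0# → a * b ≡ 0# → a ≡ 0#
  no-zero-divisorsʳ a b b≢0 ab≡0 = no-zero-divisorsˡ b a b≢0 (trans (*-comm b a) ab≡0)

  V3-≡ : ∀ {u v : V3} → x₁ u ≡ x₁ v → x₂ u ≡ x₂ v → x₃ u ≡ x₃ v → u ≡ v
  V3-≡ refl refl refl = refl

  _≟V_ : (u v : V3) → Dec (u ≡ v)
  ⟨ a , b , c ⟩ ≟V ⟨ a' , b' , c' ⟩ =
    map′ (λ (p , q , r) → V3-≡ p q r) (λ e → cong x₁ e , cong x₂ e , cong x₃ e)
         ((a ≟ a') ×-dec (b ≟ b') ×-dec (c ≟ c'))

  detecting-functional : ∀ v → ¬ v ≡ zero3 → Σ V3 λ e → ¬ dot e v ≡ 0#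
  detecting-functional ⟨ a , b , c ⟩ v≢0 with a ≟ 0# | b ≟ 0# | c ≟ 0#
  ... | no a≢0 | _ | _ = ⟨ 1# , 0# , 0# ⟩ , λ h → a≢0 (trans (solve 3 (λ a b c →
        a := con (1 , 0) :* a :+ con (0 , 0) :* b :+ con (0 , 0) :* c) refl a b c) h)
  ... | yes _ | no b≢0 | _ = ⟨ 0# , 1# , 0# ⟩ , λ h → b≢0 (trans (solve 3 (λ a b c →
        b := con (0 , 0) :* a :+ con (1 , 0) :* b :+ con (0 , 0) :* c) refl a b c) h)
  ... | yes _ | yes _ | no c≢0 = ⟨ 0# , 0# , 1# ⟩ , λ h → c≢0 (trans (solve 3 (λ a b c →
        c := con (0 , 0) :* a :+ con (0 , 0) :* b :+ con (1 , 0) :* c) refl a b c) h)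
  ... | yes a≡0 | yes b≡0 | yes c≡0 = ⊥-elim (v≢0 (V3-≡ a≡0 b≡0 c≡0))

  dot-zero : ∀ n → dot n zero3 ≡ 0#
  dot-zero ⟨ n₁ , n₂ , n₃ ⟩ = solve 3 (λ n₁ n₂ n₃ →
    n₁ :* con (0 , 0) :+ n₂ :* con (0 , 0) :+ n₃ :* con (0 , 0) := con (0 , 0)) refl n₁ n₂ n₃

  dot-scale : ∀ n s v → dot n (s · v) ≡ s * dot n v
  dot-scale ⟨ n₁ , n₂ , n₃ ⟩ s ⟨ v₁ , v₂ , v₃ ⟩ = solve 7 (λ n₁ n₂ n₃ s v₁ v₂ v₃ →
    n₁ :* (s :* v₁) :+ n₂ :* (s :* v₂) :+ n₃ :* (s :* v₃) := s :* (n₁ :* v₁ :+ n₂ :* v₂ :+ n₃ :* v₃))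
    refl n₁ n₂ n₃ s v₁ v₂ v₃

  dot-⊕ : ∀ n u v → dot n (u ⊕ v) ≡ dot n u + dot n v
  dot-⊕ ⟨ n₁ , n₂ , n₃ ⟩ ⟨ u₁ , u₂ , u₃ ⟩ ⟨ v₁ , v₂ , v₃ ⟩ = solve 9 (λ n₁ n₂ n₃ u₁ u₂ u₃ v₁ v₂ v₃ →
    n₁ :* (u₁ :+ v₁) :+ n₂ :* (u₂ :+ v₂) :+ n₃ :* (u₃ :+ v₃)
      := (n₁ :* u₁ :+ n₂ :* u₂ :+ n₃ :* u₃) :+ (n₁ :* v₁ :+ n₂ :* v₂ :+ n₃ :* v₃))
    refl n₁ n₂ n₃ u₁ u₂ u₃ v₁ v₂ v₃

  dot-⊖ : ∀ n u v → dot n (u ⊖ v) ≡ dot n u + - dot n v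
  dot-⊖ ⟨ n₁ , n₂ , n₃ ⟩ ⟨ u₁ , u₂ , u₃ ⟩ ⟨ v₁ , v₂ , v₃ ⟩ = solve 9 (λ n₁ n₂ n₃ u₁ u₂ u₃ v₁ v₂ v₃ →
    n₁ :* (u₁ :- v₁) :+ n₂ :* (u₂ :- v₂) :+ n₃ :* (u₃ :- v₃)
      := (n₁ :* u₁ :+ n₂ :* u₂ :+ n₃ :* u₃) :- (n₁ :* v₁ :+ n₂ :* v₂ :+ n₃ :* v₃))
    refl n₁ n₂ n₃ u₁ u₂ u₃ v₁ v₂ v₃

  same-level⇒kernel : ∀ n u v → dot n u ≡ dot n v → dot n (u ⊖ v) ≡ 0#
  same-level⇒kernel n u v e = trans (dot-⊖ n u v) (x≈y⇒x∙y⁻¹≈ε e)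

  kernel⇒same-level : ∀ n u v → dot n (u ⊖ v) ≡ 0# → dot n u ≡ dot n v
  kernel⇒same-level n u v e = x∙y⁻¹≈ε⇒x≈y _ _ (trans (sym (dot-⊖ n u v)) e)

  zero-scale : ∀ v → 0# · v ≡ zero3
  zero-scale ⟨ a , b , c ⟩ = V3-≡ (zeroˡ a) (zeroˡ b) (zeroˡ c)

  add-zero-multiple : ∀ v w → v ⊕ (0# · w) ≡ v
  add-zero-multiple ⟨ a , b , c ⟩ ⟨ a' , b' , c' ⟩ = V3-≡ (vanish a a') (vanish b b') (vanish c c')
    where vanish : ∀ a a' → a + 0# * a' ≡ a
          vanish a a' = solve 2 (λ a a' → a :+ con (0 , 0) :* a' := a) refl a a'

  scale-assoc : ∀ s t v → s · (t · v) ≡ (s * t) · v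
  scale-assoc s t ⟨ a , b , c ⟩ = V3-≡ (assoc a) (assoc b) (assoc c)
    where assoc : ∀ a → s * (t * a) ≡ (s * t) * a
          assoc a = solve 3 (λ s t a → s :* (t :* a) := (s :* t) :* a) refl s t a

  unit-scale : ∀ v → 1# · v ≡ v
  unit-scale ⟨ a , b , c ⟩ = V3-≡ (*-identityˡ a) (*-identityˡ b) (*-identityˡ c)

  scale-zero⇒zero : ∀ s v → ¬ v ≡ zero3 → s · v ≡ zero3 → s ≡ 0#
  scale-zero⇒zero s v v≢0 sv≡0 with detecting-functional v v≢0
  ... | e , ev≢0 = no-zero-divisorsʳ s (dot e v) ev≢0
        (trans (sym (dot-scale e s v)) (trans (cong (dot e) sv≡0) (dot-zero e)))

  ⊖-zero⇒≡ : ∀ u v → u ⊖ v ≡ zero3 → u ≡ v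
  ⊖-zero⇒≡ u v e = V3-≡ (x∙y⁻¹≈ε⇒x≈y _ _ (cong x₁ e)) (x∙y⁻¹≈ε⇒x≈y _ _ (cong x₂ e)) (x∙y⁻¹≈ε⇒x≈y _ _ (cong x₃ e))

  ⊖-multiple⇒on-line : ∀ u v t d → u ⊖ v ≡ t · d → u ≡ v ⊕ (t · d)
  ⊖-multiple⇒on-line ⟨ u₁ , u₂ , u₃ ⟩ ⟨ v₁ , v₂ , v₃ ⟩ t ⟨ d₁ , d₂ , d₃ ⟩ e =
    V3-≡ (coordinate u₁ v₁ d₁ (cong x₁ e)) (coordinate u₂ v₂ d₂ (cong x₂ e)) (coordinate u₃ v₃ d₃ (cong x₃ e))
    where
    coordinate : ∀ u v d → u + - v ≡ t * d → u ≡ v + t * d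
    coordinate u v d e = begin
      u              ≡⟨ solve 2 (λ u v → u := v :+ (u :- v)) refl u v ⟩
      v + (u + - v)  ≡⟨ cong (v +_) e ⟩
      v + t * d      ∎

  cross : V3 → V3 → V3
  cross u v = ⟨ x₂ u * x₃ v + - (x₃ u * x₂ v) , x₃ u * x₁ v + - (x₁ u * x₃ v) , x₁ u * x₂ v + - (x₂ u * x₁ v) ⟩

  cross-⊥ˡ : ∀ u v → dot (cross u v) u ≡ 0#
  cross-⊥ˡ ⟨ a₁ , a₂ , a₃ ⟩ ⟨ b₁ , b₂ , b₃ ⟩ = solve 6 (λ a₁ a₂ a₃ b₁ b₂ b₃ →
    (a₂ :* b₃ :- a₃ :* b₂) :* a₁ :+ (a₃ :* b₁ :- a₁ :* b₃) :* a₂ :+ (a₁ :* b₂ :- a₂ :* b₁) :* a₃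
      := con (0 , 0)) refl a₁ a₂ a₃ b₁ b₂ b₃

  cross-⊥ʳ : ∀ u v → dot (cross u v) v ≡ 0#
  cross-⊥ʳ ⟨ a₁ , a₂ , a₃ ⟩ ⟨ b₁ , b₂ , b₃ ⟩ = solve 6 (λ a₁ a₂ a₃ b₁ b₂ b₃ →
    (a₂ :* b₃ :- a₃ :* b₂) :* b₁ :+ (a₃ :* b₁ :- a₁ :* b₃) :* b₂ :+ (a₁ :* b₂ :- a₂ :* b₁) :* b₃
      := con (0 , 0)) refl a₁ a₂ a₃ b₁ b₂ b₃

  dot-comm : ∀ u v → dot u v ≡ dot v u
  dot-comm ⟨ a₁ , a₂ , a₃ ⟩ ⟨ b₁ , b₂ , b₃ ⟩ = solve 6 (λ a₁ a₂ a₃ b₁ b₂ b₃ →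
    a₁ :* b₁ :+ a₂ :* b₂ :+ a₃ :* b₃ := b₁ :* a₁ :+ b₂ :* a₂ :+ b₃ :* a₃) refl a₁ a₂ a₃ b₁ b₂ b₃

  cross-zeroˡ : ∀ v → cross zero3 v ≡ zero3
  cross-zeroˡ ⟨ b₁ , b₂ , b₃ ⟩ = V3-≡ (vanish b₃ b₂) (vanish b₁ b₃) (vanish b₂ b₁)
    where vanish : ∀ x y → 0# * x + - (0# * y) ≡ 0#
          vanish x y = solve 2 (λ x y → con (0 , 0) :* x :- con (0 , 0) :* y := con (0 , 0)) refl x y

  triple-product-expansion : ∀ a b c → cross (cross a b) c ≡ (dot a c · b) ⊖ (dot b c · a)
  triple-product-expansion ⟨ a₁ , a₂ , a₃ ⟩ ⟨ b₁ , b₂ , b₃ ⟩ ⟨ c₁ , c₂ , c₃ ⟩ = V3-≡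
    (solve 9 (λ a₁ a₂ a₃ b₁ b₂ b₃ c₁ c₂ c₃ →
      (a₃ :* b₁ :- a₁ :* b₃) :* c₃ :- (a₁ :* b₂ :- a₂ :* b₁) :* c₂
        := (a₁ :* c₁ :+ a₂ :* c₂ :+ a₃ :* c₃) :* b₁ :- (b₁ :* c₁ :+ b₂ :* c₂ :+ b₃ :* c₃) :* a₁)
      refl a₁ a₂ a₃ b₁ b₂ b₃ c₁ c₂ c₃)
    (solve 9 (λ a₁ a₂ a₃ b₁ b₂ b₃ c₁ c₂ c₃ →
      (a₁ :* b₂ :- a₂ :* b₁) :* c₁ :- (a₂ :* b₃ :- a₃ :* b₂) :* c₃
        := (a₁ :* c₁ :+ a₂ :* c₂ :+ a₃ :* c₃) :* b₂ :- (b₁ :* c₁ :+ b₂ :* c₂ :+ b₃ :* c₃) :* a₂)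
      refl a₁ a₂ a₃ b₁ b₂ b₃ c₁ c₂ c₃)
    (solve 9 (λ a₁ a₂ a₃ b₁ b₂ b₃ c₁ c₂ c₃ →
      (a₂ :* b₃ :- a₃ :* b₂) :* c₂ :- (a₃ :* b₁ :- a₁ :* b₃) :* c₁
        := (a₁ :* c₁ :+ a₂ :* c₂ :+ a₃ :* c₃) :* b₃ :- (b₁ :* c₁ :+ b₂ :* c₂ :+ b₃ :* c₃) :* a₃)
      refl a₁ a₂ a₃ b₁ b₂ b₃ c₁ c₂ c₃)

  cross-zero⇒multiple : ∀ u v → ¬ u ≡ zero3 → cross u v ≡ zero3 → Σ Carrier λ c → v ≡ c · u
  cross-zero⇒multiple u v u≢0 u×v≡0 with detecting-functional u u≢0
  ... | e , eu≢0 with inverse (dot u e) (λ h → eu≢0 (trans (dot-comm e u) h))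
  ... | k , ue·k≡1 = k * dot v e , (begin
    v                              ≡⟨ sym (unit-scale v) ⟩
    1# · v                         ≡⟨ cong (_· v) (trans (sym ue·k≡1) (*-comm _ k)) ⟩
    (k * dot u e) · v              ≡⟨ sym (scale-assoc k (dot u e) v) ⟩
    k · (dot u e · v)              ≡⟨ cong (k ·_) balanced ⟩
    k · (dot v e · u)              ≡⟨ scale-assoc k (dot v e) u ⟩
    (k * dot v e) · u              ∎)
    where
    balanced : dot u e · v ≡ dot v e · u
    balanced = ⊖-zero⇒≡ _ _ (begin
      (dot u e · v) ⊖ (dot v e · u)  ≡⟨ sym (triple-product-expansion u v e) ⟩
      cross (cross u v) e            ≡⟨ cong (λ w → cross w e) u×v≡0 ⟩
      cross zero3 e                  ≡⟨ cross-zeroˡ e ⟩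
      zero3                          ∎)

  ⊥-both⇒multiple-of-cross : ∀ u v w → ¬ cross u v ≡ zero3 → dot u w ≡ 0# → dot v w ≡ 0# →
    Σ Carrier λ c → w ≡ c · cross u v
  ⊥-both⇒multiple-of-cross u v w u×v≢0 uw≡0 vw≡0 = cross-zero⇒multiple (cross u v) w u×v≢0 (begin
    cross (cross u v) w               ≡⟨ triple-product-expansion u v w ⟩
    (dot u w · v) ⊖ (dot v w · u)     ≡⟨ cong₂ (λ s t → (s · v) ⊖ (t · u)) uw≡0 vw≡0 ⟩
    (0# · v) ⊖ (0# · u)               ≡⟨ cong₂ _⊖_ (zero-scale v) (zero-scale u) ⟩
    zero3 ⊖ zero3                     ≡⟨ V3-≡ (x≈y⇒x∙y⁻¹≈ε refl) (x≈y⇒x∙y⁻¹≈ε refl) (x≈y⇒x∙y⁻¹≈ε refl) ⟩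
    zero3                             ∎)

  common-kernel-trivial : ∀ u v e w → ¬ dot e (cross u v) ≡ 0# →
    dot u w ≡ 0# → dot v w ≡ 0# → dot e w ≡ 0# → w ≡ zero3
  common-kernel-trivial u v e w e·u×v≢0 uw≡0 vw≡0 ew≡0 =
    let c , w≡c·u×v = ⊥-both⇒multiple-of-cross u v w u×v≢0 uw≡0 vw≡0
        c≡0 = no-zero-divisorsʳ c _ e·u×v≢0
                (trans (sym (dot-scale e c (cross u v))) (trans (cong (dot e) (sym w≡c·u×v)) ew≡0))
    in trans w≡c·u×v (trans (cong (_· cross u v) c≡0) (zero-scale (cross u v)))
    where
    u×v≢0 : ¬ cross u v ≡ zero3
    u×v≢0 h = e·u×v≢0 (trans (cong (dot e) h) (dot-zero e))

  dot-line : ∀ n p t d → dot n (p ⊕ (t · d)) ≡ dot n p + t * dot n d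
  dot-line n p t d = trans (dot-⊕ n p (t · d)) (cong (dot n p +_) (dot-scale n t d))

  level-along-line : ∀ n d → OnLineAtInf d n → ∀ p t → dot n (p ⊕ (t · d)) ≡ dot n p
  level-along-line n d nd≡0 p t = begin
    dot n (p ⊕ (t · d))   ≡⟨ dot-line n p t d ⟩
    dot n p + t * dot n d ≡⟨ cong (λ x → dot n p + t * x) nd≡0 ⟩
    dot n p + t * 0#      ≡⟨ solve 2 (λ a t → a :+ t :* con (0 , 0) := a) refl (dot n p) t ⟩
    dot n p               ∎

  line-meets-level : ∀ n d → ¬ OnLineAtInf d n → ∀ p c → Σ Carrier λ t → dot n (p ⊕ (t · d)) ≡ c
  line-meets-level n d nd≢0 p c with inverse (dot n d) nd≢0
  ... | k , nd·k≡1 = (c + - dot n p) * k , (begin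
    dot n (p ⊕ (((c + - dot n p) * k) · d))     ≡⟨ dot-line n p _ d ⟩
    dot n p + ((c + - dot n p) * k) * dot n d   ≡⟨ solve 4 (λ a c k m → a :+ ((c :- a) :* k) :* m := a :+ (c :- a) :* (m :* k))
                                                     refl (dot n p) c k (dot n d) ⟩
    dot n p + (c + - dot n p) * (dot n d * k)   ≡⟨ cong (λ x → dot n p + (c + - dot n p) * x) nd·k≡1 ⟩
    dot n p + (c + - dot n p) * 1#              ≡⟨ solve 2 (λ a c → a :+ (c :- a) :* con (1 , 0) := c) refl (dot n p) c ⟩
    c                                           ∎)

  unit-step-moves : ∀ p d → ¬ d ≡ zero3 → ¬ p ⊕ (1# · d) ≡ p ⊕ (0# · d)
  unit-step-moves ⟨ p₁ , p₂ , p₃ ⟩ ⟨ d₁ , d₂ , d₃ ⟩ d≢0 e =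
    d≢0 (V3-≡ (vanish p₁ d₁ (cong x₁ e)) (vanish p₂ d₂ (cong x₂ e)) (vanish p₃ d₃ (cong x₃ e)))
    where
    vanish : ∀ p x → p + 1# * x ≡ p + 0# * x → x ≡ 0#
    vanish p x e = begin
      x                              ≡⟨ solve 2 (λ p x → x := (p :+ con (1 , 0) :* x) :- (p :+ con (0 , 0) :* x)) refl p x ⟩
      (p + 1# * x) + - (p + 0# * x)  ≡⟨ x≈y⇒x∙y⁻¹≈ε e ⟩
      0#                             ∎

  common-point⇒same-line : ∀ p q s t d → q ⊕ (s · d) ≡ p ⊕ (t · d) → OnAffLine p d q
  common-point⇒same-line ⟨ p₁ , p₂ , p₃ ⟩ ⟨ q₁ , q₂ , q₃ ⟩ s t ⟨ d₁ , d₂ , d₃ ⟩ e =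
    t + - s , V3-≡ (coordinate p₁ q₁ d₁ (cong x₁ e)) (coordinate p₂ q₂ d₂ (cong x₂ e)) (coordinate p₃ q₃ d₃ (cong x₃ e))
    where
    coordinate : ∀ p q d → q + s * d ≡ p + t * d → q ≡ p + (t + - s) * d
    coordinate p q d e = begin
      q                        ≡⟨ solve 3 (λ q s d → q := (q :+ s :* d) :- s :* d) refl q s d ⟩
      (q + s * d) + - (s * d)  ≡⟨ cong (λ x → x + - (s * d)) e ⟩
      (p + t * d) + - (s * d)  ≡⟨ solve 4 (λ p t s d → (p :+ t :* d) :- s :* d := p :+ (t :- s) :* d) refl p t s d ⟩
      p + (t + - s) * d        ∎

  nonCollinear-by-level : ∀ n a b c → ¬ b ≡ a → dot n b ≡ dot n a → ¬ dot n c ≡ dot n a →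
    NonCollinear a b c
  nonCollinear-by-level n a b c b≢a nb≡na nc≢na s t comb≡0 = s≡0 , t≡0
    where
    t≡0 : t ≡ 0#
    t≡0 = no-zero-divisorsʳ t _ (λ h → nc≢na (kernel⇒same-level n c a h)) (begin
      t * dot n (c ⊖ a)                           ≡⟨ solve 2 (λ s x → x := s :* con (0 , 0) :+ x) refl s _ ⟩
      s * 0# + t * dot n (c ⊖ a)                  ≡⟨ cong (λ x → s * x + t * dot n (c ⊖ a)) (sym (same-level⇒kernel n b a nb≡na)) ⟩
      s * dot n (b ⊖ a) + t * dot n (c ⊖ a)       ≡⟨ sym (cong₂ _+_ (dot-scale n s (b ⊖ a)) (dot-scale n t (c ⊖ a))) ⟩
      dot n (s · (b ⊖ a)) + dot n (t · (c ⊖ a))   ≡⟨ sym (dot-⊕ n _ _) ⟩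
      dot n ((s · (b ⊖ a)) ⊕ (t · (c ⊖ a)))       ≡⟨ cong (dot n) comb≡0 ⟩
      dot n zero3                                 ≡⟨ dot-zero n ⟩
      0#                                          ∎)
    s≡0 : s ≡ 0#
    s≡0 = scale-zero⇒zero s (b ⊖ a) (λ h → b≢a (⊖-zero⇒≡ b a h)) (begin
      s · (b ⊖ a)                         ≡⟨ sym (add-zero-multiple (s · (b ⊖ a)) (c ⊖ a)) ⟩
      (s · (b ⊖ a)) ⊕ (0# · (c ⊖ a))      ≡⟨ cong (λ x → (s · (b ⊖ a)) ⊕ (x · (c ⊖ a))) (sym t≡0) ⟩
      (s · (b ⊖ a)) ⊕ (t · (c ⊖ a))       ≡⟨ comb≡0 ⟩
      zero3                               ∎)

  determined-by-levels : ∀ U n n' a b c → a ∈ U → b ∈ U → c ∈ U → ¬ b ≡ a →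
    dot n a ≡ dot n b → dot n a ≡ dot n c → dot n' b ≡ dot n' a → ¬ dot n' c ≡ dot n' a →
    Determined U n
  determined-by-levels U n n' a b c a∈U b∈U c∈U b≢a na≡nb na≡nc n'b≡n'a n'c≢n'a =
    a , b , c , a∈U , b∈U , c∈U , nonCollinear-by-level n' a b c b≢a n'b≡n'a n'c≢n'a , na≡nb , na≡nc

-- Otherwise every
-- plane with line at infinity n meets both f and g; a point u of U outside
-- the plane π spanned by f and g would then form a triangle with these two
-- intersection points inside one such plane, so U ⊆ π.
module ParallelLines (F : FiniteField) where
  open FiniteField F
  open Geometry F
  open Space F

  ideal-point-on-undetermined-line : ∀ U → ¬ InAPlane U → ∀ n → ¬ Determined U n →
    ∀ pf pg d → ¬ d ≡ zero3 → LineInU U pf d → LineInU U pg d → ¬ OnAffLine pf d pg →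
    OnLineAtInf d n
  ideal-point-on-undetermined-line U notPlane n undetermined pf pg d d≢0 f⊆U g⊆U g∉f
    with dot n d ≟ 0#
  ... | yes d∈n = d∈n
  ... | no d∉n = ⊥-elim (notPlane (ν , dot ν pf , ν≢0 , U⊆π))
    where
    -- ν is the normal of the plane π through f and g
    ν : V3
    ν = cross d (pg ⊖ pf)

    ν≢0 : ¬ ν ≡ zero3
    ν≢0 ν≡0 = let c , pg⊖pf≡cd = cross-zero⇒multiple d (pg ⊖ pf) d≢0 ν≡0
              in g∉f (c , ⊖-multiple⇒on-line pg pf c d pg⊖pf≡cd)

    d∈ν : OnLineAtInf d ν
    d∈ν = cross-⊥ˡ d (pg ⊖ pf)

    g⊆π : dot ν pg ≡ dot ν pf
    g⊆π = kernel⇒same-level ν pg pf (cross-⊥ʳ d (pg ⊖ pf))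

    U⊆π : ∀ u → u ∈ U → dot ν u ≡ dot ν pf
    U⊆π u u∈U with dot ν u ≟ dot ν pf
    ... | yes u∈π = u∈π
    ... | no u∉π = ⊥-elim (undetermined
          (determined-by-levels U n ν a b u (f⊆U ta) (g⊆U tb) u∈U b≢a (trans na≡nu (sym nb≡nu)) na≡nu νb≡νa νu≢νa))
      where
      -- a ∈ f and b ∈ g are the points at the n-level of u
      ta tb : Carrier
      ta = proj₁ (line-meets-level n d d∉n pf (dot n u))
      tb = proj₁ (line-meets-level n d d∉n pg (dot n u))
      a b : Pt
      a = pf ⊕ (ta · d)
      b = pg ⊕ (tb · d)
      na≡nu : dot n a ≡ dot n u
      na≡nu = proj₂ (line-meets-level n d d∉n pf (dot n u))
      nb≡nu : dot n b ≡ dot n u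
      nb≡nu = proj₂ (line-meets-level n d d∉n pg (dot n u))
      νa≡νpf : dot ν a ≡ dot ν pf
      νa≡νpf = level-along-line ν d d∈ν pf ta
      νb≡νa : dot ν b ≡ dot ν a
      νb≡νa = trans (level-along-line ν d d∈ν pg tb) (trans g⊆π (sym νa≡νpf))
      νu≢νa : ¬ dot ν u ≡ dot ν a
      νu≢νa h = u∉π (trans h νa≡νpf)
      b≢a : ¬ b ≡ a
      b≢a h = g∉f (common-point⇒same-line pf pg tb ta d h)

-- Choose a functional e with e·(n₁ × n₂) ≠ 0; a point is determined by its
-- levels under n₁, n₂ and e.  Call the fibre U ∩ {n₁ = c} spread if it meets
-- two n₂-levels.  As n₁ is undetermined, n₂ separates the points of a spread
-- fibre, while on any other fibre e does; so x ↦ (n₁ x, that coordinate) is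
-- an injection U → F², hence a bijection as |U| = q².  A spread fibre would
-- then meet the n₂-level of f, and as n₂ is undetermined it would contain
-- two points of f at one n₂-level, which is impossible.  So every fibre is
-- unspread and meets every e-level: it is a full line with ideal point d.
module ParallelClasses (F : FiniteField) where
  open FiniteField F
  open Geometry F
  open Space F
  open Counting using (injection-onto)
  open Inverse enum using (to; from; strictlyInverseˡ; strictlyInverseʳ)

  module _ (U : List Pt) (U-unique : Unique U) (|U|≡q² : length U ≡ q ℕ.* q)
    (n₁ n₂ : V3) (n₁≢0 : ¬ n₁ ≡ zero3) (distinct : DistinctLinesAtInf n₁ n₂)
    (undetermined₁ : ¬ Determined U n₁) (undetermined₂ : ¬ Determined U n₂)
    (pf d : Pt) (d≢0 : ¬ d ≡ zero3) (d∈n₁ : OnLineAtInf d n₁) (d∈n₂ : OnLineAtInf d n₂)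
    (f⊆U : LineInU U pf d) where

    n₁×n₂≢0 : ¬ cross n₁ n₂ ≡ zero3
    n₁×n₂≢0 h = distinct (cross-zero⇒multiple n₁ n₂ n₁≢0 h)

    e : V3
    e = proj₁ (detecting-functional (cross n₁ n₂) n₁×n₂≢0)

    e·n₁×n₂≢0 : ¬ dot e (cross n₁ n₂) ≡ 0#
    e·n₁×n₂≢0 = proj₂ (detecting-functional (cross n₁ n₂) n₁×n₂≢0)

    levels-determine-point : ∀ x y → dot n₁ x ≡ dot n₁ y → dot n₂ x ≡ dot n₂ y → dot e x ≡ dot e y → x ≡ y
    levels-determine-point x y n₁x≡n₁y n₂x≡n₂y ex≡ey = sym (⊖-zero⇒≡ y x
      (common-kernel-trivial n₁ n₂ e (y ⊖ x) e·n₁×n₂≢0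
        (same-level⇒kernel n₁ y x (sym n₁x≡n₁y)) (same-level⇒kernel n₂ y x (sym n₂x≡n₂y))
        (same-level⇒kernel e y x (sym ex≡ey))))

    -- lines with ideal point d cross every e-level
    d∉e : ¬ OnLineAtInf d e
    d∉e de≡0 = d≢0 (common-kernel-trivial n₁ n₂ e d e·n₁×n₂≢0 d∈n₁ d∈n₂ de≡0)

    Spread : Carrier → Set
    Spread c = Σ Pt λ z → Σ Pt λ z' →
      z ∈ U × z' ∈ U × dot n₁ z ≡ c × dot n₁ z' ≡ c × ¬ dot n₂ z ≡ dot n₂ z'

    spread? : ∀ c → Dec (Spread c)
    spread? c with any? (λ z → (dot n₁ z ≟ c) ×-dec any? (λ z' → (dot n₁ z' ≟ c) ×-dec ¬? (dot n₂ z ≟ dot n₂ z')) U) U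
    ... | yes found = let z , z∈U , n₁z≡c , found' = find found
                          z' , z'∈U , n₁z'≡c , n₂z≢n₂z' = find found'
                      in yes (z , z' , z∈U , z'∈U , n₁z≡c , n₁z'≡c , n₂z≢n₂z')
    ... | no none = no λ (z , z' , z∈U , z'∈U , n₁z≡c , n₁z'≡c , n₂z≢n₂z') →
                       none (lose z∈U (n₁z≡c , lose z'∈U (n₁z'≡c , n₂z≢n₂z')))

    -- on a spread fibre n₂ is injective: two distinct points at one n₂-level
    -- and a point at another n₂-level would show that n₁ is determined
    spread⇒n₂-injective : ∀ {c} → Spread c → ∀ {x y} → x ∈ U → y ∈ U →
      dot n₁ x ≡ c → dot n₁ y ≡ c → dot n₂ x ≡ dot n₂ y → x ≡ y
    spread⇒n₂-injective {c} (z , z' , z∈U , z'∈U , n₁z≡c , n₁z'≡c , n₂z≢n₂z') {x} {y} x∈U y∈U n₁x≡c n₁y≡c n₂x≡n₂y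
      with x ≟V y
    ... | yes x≡y = x≡y
    ... | no x≢y = ⊥-elim (n₂z≢n₂z' (trans (at-level-of-x z z∈U n₁z≡c) (sym (at-level-of-x z' z'∈U n₁z'≡c))))
      where
      at-level-of-x : ∀ w → w ∈ U → dot n₁ w ≡ c → dot n₂ w ≡ dot n₂ x
      at-level-of-x w w∈U n₁w≡c with dot n₂ w ≟ dot n₂ x
      ... | yes same = same
      ... | no other = ⊥-elim (undetermined₁ (determined-by-levels U n₁ n₂ x y w x∈U y∈U w∈U
              (λ y≡x → x≢y (sym y≡x)) (trans n₁x≡c (sym n₁y≡c)) (trans n₁x≡c (sym n₁w≡c)) (sym n₂x≡n₂y) other))

    unspread⇒n₂-constant : ∀ {c} → ¬ Spread c → ∀ {x y} → x ∈ U → y ∈ U →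
      dot n₁ x ≡ c → dot n₁ y ≡ c → dot n₂ x ≡ dot n₂ y
    unspread⇒n₂-constant ¬spread {x} {y} x∈U y∈U n₁x≡c n₁y≡c with dot n₂ x ≟ dot n₂ y
    ... | yes same = same
    ... | no other = ⊥-elim (¬spread (x , y , x∈U , y∈U , n₁x≡c , n₁y≡c , other))

    fibre-coordinate : ∀ {c} → Dec (Spread c) → Pt → Carrier
    fibre-coordinate (yes _) = dot n₂
    fibre-coordinate (no _)  = dot e

    fibre-coordinate-injective : ∀ {c} (s : Dec (Spread c)) {x y} → x ∈ U → y ∈ U →
      dot n₁ x ≡ c → dot n₁ y ≡ c → fibre-coordinate s x ≡ fibre-coordinate s y → x ≡ y
    fibre-coordinate-injective (yes spread) x∈U y∈U n₁x≡c n₁y≡c = spread⇒n₂-injective spread x∈U y∈U n₁x≡c n₁y≡c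
    fibre-coordinate-injective (no ¬spread) {x} {y} x∈U y∈U n₁x≡c n₁y≡c =
      levels-determine-point x y (trans n₁x≡c (sym n₁y≡c)) (unspread⇒n₂-constant ¬spread x∈U y∈U n₁x≡c n₁y≡c)

    label : Pt → Fin (q ℕ.* q)
    label x = combine (to (dot n₁ x)) (to (fibre-coordinate (spread? (dot n₁ x)) x))

    label-injective : ∀ {x y} → x ∈ U → y ∈ U → label x ≡ label y → x ≡ y
    label-injective {x} {y} x∈U y∈U lx≡ly =
      let n₁x≡n₁y , coordinates≡ = combine-injective _ _ _ _ lx≡ly
          n₁y≡n₁x = sym (to-injective n₁x≡n₁y)
      in fibre-coordinate-injective (spread? (dot n₁ x)) x∈U y∈U refl n₁y≡n₁x
           (trans (to-injective coordinates≡) (cong (λ c → fibre-coordinate (spread? c) y) n₁y≡n₁x))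

    -- |U| = q², so every pair (level, coordinate) is attained in U
    attained : ∀ a b → Σ Pt λ x → x ∈ U × dot n₁ x ≡ a × fibre-coordinate (spread? a) x ≡ b
    attained a b =
      let x , x∈U , lx≡ab = injection-onto U U-unique |U|≡q² label label-injective (combine (to a) (to b))
          n₁x≡a , coordinate≡b = combine-injective _ _ _ _ lx≡ab
      in x , x∈U , to-injective n₁x≡a ,
         subst (λ c → fibre-coordinate (spread? c) x ≡ b) (to-injective n₁x≡a) (to-injective coordinate≡b)

    coordinate-on-spread : ∀ {c} (s : Dec (Spread c)) → Spread c → ∀ x → fibre-coordinate s x ≡ dot n₂ x
    coordinate-on-spread (yes _) _ x = refl
    coordinate-on-spread (no ¬spread) spread x = ⊥-elim (¬spread spread)

    coordinate-on-unspread : ∀ {c} (s : Dec (Spread c)) → ¬ Spread c → ∀ x → fibre-coordinate s x ≡ dot e x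
    coordinate-on-unspread (yes spread) ¬spread x = ⊥-elim (¬spread spread)
    coordinate-on-unspread (no _) _ x = refl

    P₀ P₁ : Pt
    P₀ = pf ⊕ (0# · d)
    P₁ = pf ⊕ (1# · d)

    P₁≢P₀ : ¬ P₁ ≡ P₀
    P₁≢P₀ = unit-step-moves pf d d≢0

    same-levels-on-f : ∀ n → OnLineAtInf d n → dot n P₁ ≡ dot n P₀
    same-levels-on-f n d∈n = trans (level-along-line n d d∈n pf 1#) (sym (level-along-line n d d∈n pf 0#))

    -- (n₂ undetermined) the n₂-plane through f meets U only in the n₁-plane of f
    n₂-level-of-f⇒n₁-level-of-f : ∀ y → y ∈ U → dot n₂ y ≡ dot n₂ P₀ → dot n₁ y ≡ dot n₁ P₀
    n₂-level-of-f⇒n₁-level-of-f y y∈U n₂y≡n₂P₀ with dot n₁ y ≟ dot n₁ P₀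
    ... | yes same = same
    ... | no other = ⊥-elim (undetermined₂ (determined-by-levels U n₂ n₁ P₀ P₁ y (f⊆U 0#) (f⊆U 1#) y∈U
            P₁≢P₀ (sym (same-levels-on-f n₂ d∈n₂)) (sym n₂y≡n₂P₀) (same-levels-on-f n₁ d∈n₁) other))

    -- a spread fibre meets the n₂-level of f (by `attained`), hence contains
    -- the points P₀ ≠ P₁ of f, which share an n₂-level: impossible
    no-fibre-spread : ∀ c → ¬ Spread c
    no-fibre-spread c spread =
      let y , y∈U , n₁y≡c , coordinate≡ = attained c (dot n₂ P₀)
          n₁P₀≡c = trans (sym (n₂-level-of-f⇒n₁-level-of-f y y∈U
                     (trans (sym (coordinate-on-spread (spread? c) spread y)) coordinate≡))) n₁y≡c
      in P₁≢P₀ (spread⇒n₂-injective spread (f⊆U 1#) (f⊆U 0#)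
                 (trans (same-levels-on-f n₁ d∈n₁) n₁P₀≡c) n₁P₀≡c (same-levels-on-f n₂ d∈n₂))

    fibre-point-on-line : ∀ u x t → u ∈ U → x ∈ U → dot n₁ x ≡ dot n₁ u →
      dot e x ≡ dot e (u ⊕ (t · d)) → x ≡ u ⊕ (t · d)
    fibre-point-on-line u x t u∈U x∈U n₁x≡n₁u ex≡e[u+td] = levels-determine-point x (u ⊕ (t · d))
      (trans n₁x≡n₁u (sym (level-along-line n₁ d d∈n₁ u t)))
      (trans (unspread⇒n₂-constant (no-fibre-spread (dot n₁ u)) x∈U u∈U n₁x≡n₁u refl)
             (sym (level-along-line n₂ d d∈n₂ u t)))
      ex≡e[u+td]

    same-fibre⇒same-line : ∀ u v → u ∈ U → v ∈ U → dot n₁ u ≡ dot n₁ v → OnAffLine u d v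
    same-fibre⇒same-line u v u∈U v∈U n₁u≡n₁v =
      let t , e[u+td]≡ev = line-meets-level e d d∉e u (dot e v)
      in t , fibre-point-on-line u v t u∈U v∈U (sym n₁u≡n₁v) (sym e[u+td]≡ev)

    line-through-point-in-U : ∀ u → u ∈ U → LineInU U u d
    line-through-point-in-U u u∈U t =
      let x , x∈U , n₁x≡n₁u , coordinate≡ = attained (dot n₁ u) (dot e (u ⊕ (t · d)))
          ex≡ = trans (sym (coordinate-on-unspread (spread? (dot n₁ u)) (no-fibre-spread (dot n₁ u)) x)) coordinate≡
      in subst (_∈ U) (fibre-point-on-line u x t u∈U x∈U n₁x≡n₁u ex≡) x∈U

    -- the line of U in the plane n₁ = c, for c the i-th element of F
    base-point : Fin q → Pt
    base-point i = proj₁ (attained (from i) 0#)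

    base-point∈U : ∀ i → base-point i ∈ U
    base-point∈U i = proj₁ (proj₂ (attained (from i) 0#))

    base-point-level : ∀ i → dot n₁ (base-point i) ≡ from i
    base-point-level i = proj₁ (proj₂ (proj₂ (attained (from i) 0#)))

    union-of-parallel-lines : Σ (Fin q → Pt) λ p →
      (∀ i j → OnAffLine (p i) d (p j) → i ≡ j) ×
      (∀ x → x ∈ U → Σ (Fin q) λ i → OnAffLine (p i) d x) ×
      (∀ i x → OnAffLine (p i) d x → x ∈ U)
    union-of-parallel-lines = base-point , disjoint , covering , contained
      where
      disjoint : ∀ i j → OnAffLine (base-point i) d (base-point j) → i ≡ j
      disjoint i j (t , pj≡pi+td) = begin
        i                           ≡⟨ sym (strictlyInverseˡ i) ⟩
        to (from i)                 ≡⟨ cong to (sym (base-point-level i)) ⟩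
        to (dot n₁ (base-point i))  ≡⟨ cong to (sym (level-along-line n₁ d d∈n₁ (base-point i) t)) ⟩
        to (dot n₁ (base-point i ⊕ (t · d))) ≡⟨ cong (λ x → to (dot n₁ x)) (sym pj≡pi+td) ⟩
        to (dot n₁ (base-point j))  ≡⟨ cong to (base-point-level j) ⟩
        to (from j)                 ≡⟨ strictlyInverseˡ j ⟩
        j                           ∎
        where open ≡-Reasoning

      covering : ∀ x → x ∈ U → Σ (Fin q) λ i → OnAffLine (base-point i) d x
      covering x x∈U = to (dot n₁ x) , same-fibre⇒same-line (base-point _) x (base-point∈U _) x∈U
        (trans (base-point-level _) (strictlyInverseʳ (dot n₁ x)))

      contained : ∀ i x → OnAffLine (base-point i) d x → x ∈ U
      contained i x (t , x≡pi+td) = subst (_∈ U) (sym x≡pi+td) (line-through-point-in-U (base-point i) (base-point∈U i) t)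

-- The theorem: by Proposition 1 (applied to ℓ₂) the common ideal point of f
-- and g is the point M = ℓ₁ ∩ ℓ₂, and Proposition 2 decomposes U.
corollary2 : (F : FiniteField) → let open Geometry F in
    (U : List Pt) → Unique U → length U ≡ Data.Nat._*_ q q → ¬ InAPlane U →
    (n₁ n₂ : V3) → ¬ (n₁ ≡ zero3) → ¬ (n₂ ≡ zero3) → DistinctLinesAtInf n₁ n₂ →
    ¬ Determined U n₁ → ¬ Determined U n₂ →
    (pf pg d : Pt) → ¬ (d ≡ zero3) → OnLineAtInf d n₁ →
    LineInU U pf d → LineInU U pg d → ¬ OnAffLine pf d pg →
    Σ V3 λ m → ¬ (m ≡ zero3) × OnLineAtInf m n₁ × OnLineAtInf m n₂ ×
    Σ (Fin q → Pt) λ p →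
    (∀ i j → OnAffLine (p i) m (p j) → i ≡ j) ×
    (∀ x → x ∈ U → Σ (Fin q) λ i → OnAffLine (p i) m x) ×
    (∀ i x → OnAffLine (p i) m x → x ∈ U)
corollary2 F U U-unique |U|≡q² notPlane n₁ n₂ n₁≢0 _ distinct undetermined₁ undetermined₂
           pf pg d d≢0 d∈n₁ f⊆U g⊆U g∉f =
  d , d≢0 , d∈n₁ , d∈n₂ ,
  ParallelClasses.union-of-parallel-lines F U U-unique |U|≡q² n₁ n₂ n₁≢0 distinct
    undetermined₁ undetermined₂ pf d d≢0 d∈n₁ d∈n₂ f⊆U
  where
  d∈n₂ : Geometry.OnLineAtInf F d n₂
  d∈n₂ = ParallelLines.ideal-point-on-undetermined-line F U notPlane n₂ undetermined₂ pf pg d d≢0 f⊆U g⊆U g∉f
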